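{- For any $B\subseteq\omega$: $B\in H(\mathcal{I}_d)$ if and only if $\underline{d}(B)>0$.
   Context: $\mathcal{I}_d=\{A\subseteq\omega:\lim_{n\to\infty}|A\cap n|/n=0\}$ and $\underline{d}(B)=\liminf_{n\to\infty}|B\cap n|/n$ is the lower asymptotic density. For $Y\subseteq\omega$, $\mathcal{I}_d|Y=\{A\cap Y:A\in\mathcal{I}_d\}$. Ideals $\mathcal{I}$ on $S$, $\mathcal{J}$ on $T$ are isomorphic ($\cong$) if there is a bijection $h\colon T\to S$ with $A\in\mathcal{I}\iff h^{ -1}[A]\in\mathcal{J}$ for all $A\subseteq S$. $H(\mathcal{I}_d)=\{A\subseteq\omega:\mathcal{I}_d|A\cong\mathcal{I}_d\}$. -}

module Defs where

open import Data.Nat using (ℕ; zero; suc; _+_; _*_; _≤_)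
open import Data.Bool using (Bool; true; false; T; _∧_; if_then_else_)
open import Data.Product using (Σ; ∃; _×_; proj₁)
open import Relation.Binary.PropositionalEquality using (_≡_)
open import Function.Definitions using (Bijective)
open import Function.Bundles using (_⇔_)

Subset : Set
Subset = ℕ → Bool

_⊆_ : Subset → Subset → Set
A ⊆ B = ∀ n → T (A n) → T (B n)

-- |A ∩ n| = #{ i < n : i ∈ A }
count : Subset → ℕ → ℕ
count A zero = 0
count A (suc n) = (if A n then 1 else 0) + count A n

-- A ∈ I_d  iff  lim |A ∩ n|/n = 0,
-- i.e. for every k, eventually k·|A ∩ n| ≤ n (|A∩n|/n ≤ 1/k).
InId : Subset → Set
InId A = ∀ k → ∃ λ N → ∀ n → N ≤ n → k * count A n ≤ n

-- lower density of B is > 0  iff  there are k, N with n ≤ k·|B ∩ n| for n ≥ N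
-- (liminf |B∩n|/n ≥ 1/k).
PosLowerDensity : Subset → Set
PosLowerDensity B = ∃ λ k → ∃ λ N → ∀ n → N ≤ n → n ≤ k * count B n

Elem : Subset → Set
Elem B = Σ ℕ (λ n → T (B n))

-- Membership in I_d|B = { A ∩ B : A ∈ I_d } (a subset A' of B is given as A' ⊆ B).
InRestr : Subset → Subset → Set
InRestr B A' = ∃ λ C → InId C × (∀ n → A' n ≡ (C n ∧ B n))

IdRestrIsoId : Subset → Set
IdRestrIsoId B =
  Σ (ℕ → Elem B) λ h →
    Bijective _≡_ _≡_ h ×
    (∀ (A' : Subset) → A' ⊆ B → (InRestr B A' ⇔ InId (λ m → A' (proj₁ (h m)))))

InH : Subset → Set
InH B = IdRestrIsoId B

-- If B has lower density at least 1/K, the increasing enumeration of B stretches indices by at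
-- most a factor K and never shrinks them, so it carries I_d onto I_d|B.  Conversely, let h be
-- an isomorphism witnessing B ∈ H(I_d) while B has lower density 0.  Choose t₀ < t₁ < ⋯ with
-- 2(j+1)·|B ∩ t_j| < t_j and h[0, j] ⊆ t_j, and let W be the set of x that lie below 2|B ∩ t_j|
-- but are sent to at least t_j, for some j.  Below any n ∈ [t_j, t_{j+1}) the image h[W] has at
-- most 2|B ∩ t_j| < n/(j+1) points, so h[W] ∈ I_d|B; yet for each j at most |B ∩ t_j| of the
-- points below 2|B ∩ t_j| are sent below t_j, so W = h⁻¹[h[W]] has upper density at least 1/2.
module Submission where

open import Level using (0ℓ)
open import Axiom.ExcludedMiddle using (ExcludedMiddle)
open import Data.Nat
open import Data.Nat.Properties
open import Data.Bool using (true; false; T; _∧_; not; if_then_else_)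
open import Data.Bool.Properties using (T-irrelevant; T-∧; T-≡)
open import Data.Product
open import Data.Sum using (_⊎_; inj₁; inj₂)
open import Data.Empty using (⊥-elim)
open import Function.Base using (_∘_)
open import Function.Bundles using (_⇔_; mk⇔; Equivalence)
open import Function.Definitions using (Bijective)
open import Relation.Binary.Definitions using (tri<; tri≈; tri>)
open import Relation.Binary.PropositionalEquality
open import Relation.Nullary using (¬_; yes; no)
open import Relation.Nullary.Decidable using (isYes; toWitness; fromWitness; T?; decidable-stable)
open import Defs

private
  variable
    P Q : Subset
    m n : ℕ

count-cong : ∀ n → (∀ z → z < n → P z ≡ Q z) → count P n ≡ count Q n
count-cong zero    eq = refl
count-cong {P} {Q} (suc n) eq rewrite eq n ≤-refl =
  cong ((if Q n then 1 else 0) +_) (count-cong n (λ z z<n → eq z (m≤n⇒m≤1+n z<n)))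

count≤n : ∀ P n → count P n ≤ n
count≤n P zero = z≤n
count≤n P (suc n) with P n
... | true  = s≤s (count≤n P n)
... | false = m≤n⇒m≤1+n (count≤n P n)

count-all : ∀ n → count (λ _ → true) n ≡ n
count-all zero    = refl
count-all (suc n) = cong suc (count-all n)

count-monoˡ : P ⊆ Q → ∀ n → count P n ≤ count Q n
count-monoˡ P⊆Q zero = z≤n
count-monoˡ {P} {Q} P⊆Q (suc n) with P n in p | Q n in q
... | true  | true  = s≤s (count-monoˡ P⊆Q n)
... | true  | false = ⊥-elim (subst T q (P⊆Q n (subst T (sym p) _)))
... | false | true  = m≤n⇒m≤1+n (count-monoˡ P⊆Q n)
... | false | false = count-monoˡ P⊆Q n

count-monoʳ : ∀ P → m ≤ n → count P m ≤ count P n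
count-monoʳ P = go ∘ ≤⇒≤′
  where
  go : m ≤′ n → count P m ≤ count P n
  go ≤′-refl           = ≤-refl
  go (≤′-step {n} m≤n) = ≤-trans (go m≤n) (m≤n+m (count P n) _)

count-suc-∈ : T (P n) → count P (suc n) ≡ suc (count P n)
count-suc-∈ {P} {n} Pn with P n
... | true = refl

count-<-∈ : T (P m) → m < n → count P m < count P n
count-<-∈ {P} {m} {n} Pm m<n = subst (_≤ count P n) (count-suc-∈ {P} Pm) (count-monoʳ P m<n)

count-injective-on : T (P m) → T (P n) → count P m ≡ count P n → m ≡ n
count-injective-on {P} {m} {n} Pm Pn eq with <-cmp m n
... | tri< m<n _ _ = ⊥-elim (<⇒≢ (count-<-∈ {P} Pm m<n) eq)
... | tri≈ _ m≡n _ = m≡n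
... | tri> _ _ n<m = ⊥-elim (<⇒≢ (count-<-∈ {P} Pn n<m) (sym eq))

-- Since count P grows in steps of at most one, it passes through every value below its maximum.
count-hits : ∀ P n i → i < count P n → ∃ λ m → T (P m) × count P m ≡ i
count-hits P (suc n) i i<c with i <? count P n
... | yes i<c′ = count-hits P n i i<c′
... | no  i≮c′ with P n in Pn
...   | true  = n , subst T (sym Pn) _ , ≤-antisym (≮⇒≥ i≮c′) (≤-pred i<c)
...   | false = ⊥-elim (i≮c′ i<c)

count-cover : ∀ n → (∀ x → x < n → T (P x) ⊎ T (Q x)) → n ≤ count P n + count Q n
count-cover zero    cover = z≤n
count-cover {P} {Q} (suc n) cover
  with P n | Q n | cover n ≤-refl | count-cover n (λ x x<n → cover x (m≤n⇒m≤1+n x<n))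
... | true  | true  | _      | ih = s≤s (≤-trans ih (+-monoʳ-≤ (count P n) (n≤1+n _)))
... | true  | false | _      | ih = s≤s ih
... | false | true  | _      | ih = subst (suc n ≤_) (sym (+-suc (count P n) (count Q n))) (s≤s ih)
... | false | false | inj₁ () | _
... | false | false | inj₂ () | _

remove : Subset → ℕ → Subset
remove Q y z = Q z ∧ not (z ≡ᵇ y)

remove-≢ : ∀ Q {y z} → z ≢ y → remove Q y z ≡ Q z
remove-≢ Q {y} {z} z≢y with z ≡ᵇ y in eq
... | true  = ⊥-elim (z≢y (≡ᵇ⇒≡ z y (subst T (sym eq) _)))
... | false with Q z
...   | true  = refl
...   | false = refl

remove-self : ∀ Q y → remove Q y y ≡ false
remove-self Q y with y ≡ᵇ y in eq
... | false = ⊥-elim (subst T eq (≡⇒≡ᵇ y y refl))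
... | true with Q y
...   | true  = refl
...   | false = refl

count-remove : ∀ Q {y} n → y < n → T (Q y) → suc (count (remove Q y) n) ≡ count Q n
count-remove Q {y} (suc n) y<n Qy with n ≟ y
... | yes refl rewrite remove-self Q n | count-suc-∈ {Q} Qy =
  cong suc (count-cong n (λ z z<n → remove-≢ Q (<⇒≢ z<n)))
... | no  n≢y rewrite remove-≢ Q n≢y =
  trans (sym (+-suc (if Q n then 1 else 0) _))
        (cong ((if Q n then 1 else 0) +_) (count-remove Q n (≤∧≢⇒< (≤-pred y<n) (n≢y ∘ sym)) Qy))

pigeonhole : ∀ (f : ℕ → ℕ) a b →
             (∀ x → x < a → T (P x) → f x < b × T (Q (f x))) →
             (∀ {x y} → T (P x) → T (P y) → f x ≡ f y → x ≡ y) →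
             count P a ≤ count Q b
pigeonhole f zero    b maps inj = z≤n
pigeonhole {P} {Q} f (suc a) b maps inj with P a in Pa
... | false = pigeonhole f a b (λ x x<a → maps x (m≤n⇒m≤1+n x<a)) inj
... | true  = subst (suc (count P a) ≤_) (count-remove Q b fa<b Qfa) (s≤s ih)
  where
  pa : T (P a)
  pa = subst T (sym Pa) _
  fa<b : f a < b
  fa<b = proj₁ (maps a ≤-refl pa)
  Qfa : T (Q (f a))
  Qfa = proj₂ (maps a ≤-refl pa)
  -- f is injective, so no point below a is sent to f a, which can therefore be removed from Q.
  ih : count P a ≤ count (remove Q (f a)) b
  ih = pigeonhole f a b
         (λ x x<a Px → proj₁ (maps x (m≤n⇒m≤1+n x<a) Px) ,
            subst T (sym (remove-≢ Q (<⇒≢ x<a ∘ inj Px pa))) (proj₂ (maps x (m≤n⇒m≤1+n x<a) Px)))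
         inj

InId-⊆ : P ⊆ Q → InId Q → InId P
InId-⊆ {P} {Q} P⊆Q Q-null k with Q-null k
... | N , bound = N , λ n N≤n → ≤-trans (*-monoʳ-≤ k (count-monoˡ P⊆Q n)) (bound n N≤n)

InRestr⇔InId : ∀ {B A} → A ⊆ B → InRestr B A ⇔ InId A
InRestr⇔InId {B} {A} A⊆B = mk⇔ restricted⇒null (λ A-null → A , A-null , A≡A∧B)
  where
  restricted⇒null : InRestr B A → InId A
  restricted⇒null (C , C-null , A≡C∧B) =
    InId-⊆ (λ n An → proj₁ (Equivalence.to T-∧ (subst T (A≡C∧B n) An))) C-null
  A≡A∧B : ∀ n → A n ≡ (A n ∧ B n)
  A≡A∧B n with A n in An
  ... | false = refl
  ... | true  = sym (Equivalence.to T-≡ (A⊆B n (subst T (sym An) _)))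

Elem-≡ : ∀ {B : Subset} {m n} {p : T (B m)} {q : T (B n)} → m ≡ n → (m , p) ≡ (n , q)
Elem-≡ {p = p} {q} refl = cong (_ ,_) (T-irrelevant p q)

module PositiveLowerDensity {B : Subset} (positive : PosLowerDensity B) where

  K : ℕ
  K = proj₁ positive

  N₀ : ℕ
  N₀ = proj₁ (proj₂ positive)

  dense : ∀ n → N₀ ≤ n → n ≤ K * count B n
  dense = proj₂ (proj₂ positive)

  instance
    K-nonZero : NonZero K
    K-nonZero = ≢-nonZero λ K≡0 →
      n≮0 (subst (λ k → N₀ < k * count B (suc N₀)) K≡0 (dense (suc N₀) (n≤1+n N₀)))

  count-unbounded : ∀ i → i < count B (N₀ + suc (K * i))
  count-unbounded i = ≰⇒> λ c≤i →
    <⇒≱ (m≤n+m (suc (K * i)) N₀) (≤-trans (dense _ (m≤m+n N₀ _)) (*-monoʳ-≤ K c≤i))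

  element-with-count : ∀ i → ∃ λ n → T (B n) × count B n ≡ i
  element-with-count i = count-hits B (N₀ + suc (K * i)) i (count-unbounded i)

  nth : ℕ → ℕ
  nth i = proj₁ (element-with-count i)

  nth-∈ : ∀ i → T (B (nth i))
  nth-∈ i = proj₁ (proj₂ (element-with-count i))

  count-nth : ∀ i → count B (nth i) ≡ i
  count-nth i = proj₂ (proj₂ (element-with-count i))

  nth-count : T (B n) → nth (count B n) ≡ n
  nth-count {n} Bn = count-injective-on {B} (nth-∈ (count B n)) Bn (count-nth (count B n))

  i≤nth : ∀ i → i ≤ nth i
  i≤nth i = subst (_≤ nth i) (count-nth i) (count≤n B (nth i))

  nth≤K* : ∀ i → N₀ ≤ nth i → nth i ≤ K * i
  nth≤K* i N₀≤ = subst (λ c → nth i ≤ K * c) (count-nth i) (dense (nth i) N₀≤)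

  enumerate : ℕ → Elem B
  enumerate i = nth i , nth-∈ i

  enumerate-bijective : Bijective _≡_ _≡_ enumerate
  enumerate-bijective =
    (λ {i} {j} eq → trans (sym (count-nth i)) (trans (cong (count B ∘ proj₁) eq) (count-nth j))) ,
    λ { (n , Bn) → count B n , λ { refl → Elem-≡ (nth-count Bn) } }

  count-pullback : ∀ {A} → A ⊆ B → ∀ n → count A n ≡ count (A ∘ nth) (count B n)
  count-pullback A⊆B zero = refl
  count-pullback {A} A⊆B (suc n) with B n in Bn
  ... | true rewrite nth-count (subst T (sym Bn) _) =
    cong ((if A n then 1 else 0) +_) (count-pullback A⊆B n)
  ... | false with A n in An
  ...   | true  = ⊥-elim (subst T Bn (A⊆B n (subst T (sym An) _)))
  ...   | false = count-pullback A⊆B n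

  InId-pullback : ∀ {A} → A ⊆ B → InId A ⇔ InId (A ∘ nth)
  InId-pullback {A} A⊆B = mk⇔ null⇒pullback-null pullback-null⇒null
    where
    count-at-nth : ∀ i → count A (nth i) ≡ count (A ∘ nth) i
    count-at-nth i = trans (count-pullback A⊆B (nth i)) (cong (count (A ∘ nth)) (count-nth i))

    null⇒pullback-null : InId A → InId (A ∘ nth)
    null⇒pullback-null A-null k with A-null (k * K)
    ... | N , bound = N₀ ⊔ N , bound-nth
      where
      open ≤-Reasoning
      bound-nth : ∀ i → N₀ ⊔ N ≤ i → k * count (A ∘ nth) i ≤ i
      bound-nth i N₀⊔N≤i = *-cancelˡ-≤ K (begin
        K * (k * count (A ∘ nth) i) ≡⟨ sym (*-assoc K k _) ⟩
        K * k * count (A ∘ nth) i   ≡⟨ cong₂ _*_ (*-comm K k) (sym (count-at-nth i)) ⟩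
        k * K * count A (nth i)     ≤⟨ bound (nth i) (≤-trans (m≤n⊔m N₀ N) N₀⊔N≤nth) ⟩
        nth i                       ≤⟨ nth≤K* i (≤-trans (m≤m⊔n N₀ N) N₀⊔N≤nth) ⟩
        K * i                       ∎)
        where
        N₀⊔N≤nth : N₀ ⊔ N ≤ nth i
        N₀⊔N≤nth = ≤-trans N₀⊔N≤i (i≤nth i)

    pullback-null⇒null : InId (A ∘ nth) → InId A
    pullback-null⇒null pullback-null k with pullback-null k
    ... | N , bound = k * N , λ n kN≤n →
      subst (λ c → k * c ≤ n) (sym (count-pullback A⊆B n)) (bound′ n kN≤n)
      where
      bound′ : ∀ n → k * N ≤ n → k * count (A ∘ nth) (count B n) ≤ n
      bound′ n kN≤n with N ≤? count B n
      ... | yes N≤c = ≤-trans (bound (count B n) N≤c) (count≤n B n)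
      ... | no  N≰c = ≤-trans (*-monoʳ-≤ k (≤-trans (count≤n _ (count B n)) (<⇒≤ (≰⇒> N≰c)))) kN≤n

  inH : InH B
  inH = enumerate , enumerate-bijective , λ A A⊆B →
    mk⇔ (Equivalence.to (InId-pullback A⊆B) ∘ Equivalence.to (InRestr⇔InId A⊆B))
        (Equivalence.from (InRestr⇔InId A⊆B) ∘ Equivalence.from (InId-pullback A⊆B))

¬PosLowerDensity⇒sparse : ExcludedMiddle 0ℓ → ∀ {B} → ¬ PosLowerDensity B →
                          ∀ K N → ∃ λ n → N ≤ n × K * count B n < n
¬PosLowerDensity⇒sparse em ¬positive K N =
  decidable-stable em λ ¬sparse → ¬positive (K , N , λ n N≤n → ≮⇒≥ (λ lt → ¬sparse (n , N≤n , lt)))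

runningMax : (ℕ → ℕ) → ℕ → ℕ
runningMax f zero    = f zero
runningMax f (suc j) = runningMax f j ⊔ f (suc j)

≤-runningMax : ∀ f {x} j → x ≤ j → f x ≤ runningMax f j
≤-runningMax f zero z≤n = ≤-refl
≤-runningMax f {x} (suc j) x≤1+j with m≤n⇒m<n∨m≡n x≤1+j
... | inj₁ x<1+j = ≤-trans (≤-runningMax f j (≤-pred x<1+j)) (m≤m⊔n _ (f (suc j)))
... | inj₂ refl  = m≤n⊔m (runningMax f j) (f (suc j))

module StrictlyIncreasing (t : ℕ → ℕ) (t-step : ∀ j → t j < t (suc j)) where

  t-mono : ∀ {i j} → i ≤ j → t i ≤ t j
  t-mono = go ∘ ≤⇒≤′
    where
    go : ∀ {i j} → i ≤′ j → t i ≤ t j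
    go ≤′-refl           = ≤-refl
    go (≤′-step {j} i≤j) = ≤-trans (go i≤j) (<⇒≤ (t-step j))

  t-reflect : ∀ {i j} → t i < t (suc j) → i ≤ j
  t-reflect lt = ≮⇒≥ (λ j<i → <⇒≱ lt (t-mono j<i))

  bracket : ∀ k n → t k ≤ n → ∃ λ j → k ≤ j × t j ≤ n × n < t (suc j)
  bracket k zero    tk≤n = k , ≤-refl , tk≤n , ≤-<-trans z≤n (t-step k)
  bracket k (suc n) tk≤1+n with t k ≤? n
  ... | no  tk≰n = k , ≤-refl , tk≤1+n ,
                   subst (_< t (suc k)) (≤-antisym tk≤1+n (≰⇒> tk≰n)) (t-step k)
  ... | yes tk≤n with bracket k n tk≤n
  ...   | j , k≤j , tj≤n , n<t1+j with suc n <? t (suc j)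
  ...     | yes 1+n<t1+j = j , k≤j , m≤n⇒m≤1+n tj≤n , 1+n<t1+j
  ...     | no  1+n≮t1+j = suc j , m≤n⇒m≤1+n k≤j , ≮⇒≥ 1+n≮t1+j ,
              subst (_< t (suc (suc j))) (≤-antisym (≮⇒≥ 1+n≮t1+j) n<t1+j) (t-step (suc j))

module LowerDensityZero (em : ExcludedMiddle 0ℓ) {B : Subset}
                        (sparse : ∀ K N → ∃ λ n → N ≤ n × K * count B n < n)
                        (h : ℕ → Elem B) (h-bijective : Bijective _≡_ _≡_ h) where

  H : ℕ → ℕ
  H = proj₁ ∘ h

  H-injective : ∀ {x y} → H x ≡ H y → x ≡ y
  H-injective eq = proj₁ h-bijective (Elem-≡ eq)

  t lowerBound : ℕ → ℕ
  t j = proj₁ (sparse (2 * suc j) (lowerBound j))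
  lowerBound zero    = suc (runningMax H zero)
  lowerBound (suc j) = suc (t j ⊔ runningMax H (suc j))

  lowerBound≤t : ∀ j → lowerBound j ≤ t j
  lowerBound≤t j = proj₁ (proj₂ (sparse (2 * suc j) (lowerBound j)))

  t-sparse : ∀ j → 2 * suc j * count B (t j) < t j
  t-sparse j = proj₂ (proj₂ (sparse (2 * suc j) (lowerBound j)))

  t-step : ∀ j → t j < t (suc j)
  t-step j = ≤-trans (s≤s (m≤m⊔n (t j) _)) (lowerBound≤t (suc j))

  runningMax<t : ∀ j → runningMax H j < t j
  runningMax<t zero    = lowerBound≤t zero
  runningMax<t (suc j) = ≤-trans (s≤s (m≤n⊔m (t j) _)) (lowerBound≤t (suc j))

  open StrictlyIncreasing t t-step

  j<count-t : ∀ j → j < count B (t j)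
  j<count-t j = subst (_≤ count B (t j)) (count-all (suc j))
    (pigeonhole H (suc j) (t j)
       (λ x x≤j _ → ≤-<-trans (≤-runningMax H j (≤-pred x≤j)) (runningMax<t j) , proj₂ (h x))
       (λ _ _ → H-injective))

  Displaced : ℕ → Set
  Displaced x = ∃ λ j → x < 2 * count B (t j) × t j ≤ H x

  W : Subset
  W x = isYes (em {Displaced x})

  h⁻¹ : ℕ → ℕ
  h⁻¹ m with T? (B m)
  ... | yes Bm = proj₁ (proj₂ h-bijective (m , Bm))
  ... | no  _  = 0

  H-h⁻¹ : ∀ {m} → T (B m) → H (h⁻¹ m) ≡ m
  H-h⁻¹ {m} Bm with T? (B m)
  ... | yes Bm′ = cong proj₁ (proj₂ (proj₂ h-bijective (m , Bm′)) refl)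
  ... | no ¬Bm  = ⊥-elim (¬Bm Bm)

  h⁻¹-H : ∀ x → h⁻¹ (H x) ≡ x
  h⁻¹-H x = H-injective (H-h⁻¹ (proj₂ (h x)))

  A : Subset
  A m = B m ∧ W (h⁻¹ m)

  A⊆B : A ⊆ B
  A⊆B m Am = proj₁ (Equivalence.to T-∧ Am)

  -- A point m < t_{j+1} of A comes from a window [0, 2|B ∩ t_i|) with t_i ≤ m, so i ≤ j.
  count-A : ∀ j n → n < t (suc j) → count A n ≤ 2 * count B (t j)
  count-A j n n<t1+j = subst (count A n ≤_) (count-all _) (pigeonhole h⁻¹ n _ maps h⁻¹-injective)
    where
    maps : ∀ m → m < n → T (A m) → h⁻¹ m < 2 * count B (t j) × T true
    maps m m<n Am with Equivalence.to T-∧ Am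
    ... | Bm , Wm with toWitness {a? = em {Displaced (h⁻¹ m)}} Wm
    ...   | i , in-window , ti≤H = <-≤-trans in-window (*-monoʳ-≤ 2 (count-monoʳ B (t-mono i≤j))) , _
      where
      i≤j : i ≤ j
      i≤j = t-reflect (≤-<-trans (subst (t i ≤_) (H-h⁻¹ Bm) ti≤H) (<-trans m<n n<t1+j))
    h⁻¹-injective : ∀ {m m′} → T (A m) → T (A m′) → h⁻¹ m ≡ h⁻¹ m′ → m ≡ m′
    h⁻¹-injective Am Am′ eq =
      trans (sym (H-h⁻¹ (A⊆B _ Am))) (trans (cong H eq) (H-h⁻¹ (A⊆B _ Am′)))

  A-null : InId A
  A-null k = t k , bound
    where
    bound : ∀ n → t k ≤ n → k * count A n ≤ n
    bound n tk≤n with bracket k n tk≤n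
    ... | j , k≤j , tj≤n , n<t1+j = begin
      k * count A n                  ≤⟨ *-mono-≤ (m≤n⇒m≤1+n k≤j) (count-A j n n<t1+j) ⟩
      suc j * (2 * count B (t j))    ≡⟨ sym (*-assoc (suc j) 2 (count B (t j))) ⟩
      suc j * 2 * count B (t j)      ≡⟨ cong (_* count B (t j)) (*-comm (suc j) 2) ⟩
      2 * suc j * count B (t j)      ≤⟨ <⇒≤ (t-sparse j) ⟩
      t j                            ≤⟨ tj≤n ⟩
      n                              ∎
      where open ≤-Reasoning

  -- Of the 2|B ∩ t_j| points of the window at most |B ∩ t_j| are sent below t_j; the rest are in h⁻¹[A].
  count-h⁻¹[A] : ∀ j → count B (t j) ≤ count (A ∘ H) (2 * count B (t j))
  count-h⁻¹[A] j = +-cancelʳ-≤ c c _ (begin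
    c + c                                           ≡⟨ cong (c +_) (sym (+-identityʳ c)) ⟩
    2 * c                                           ≤⟨ count-cover (2 * c) window-covered ⟩
    count (A ∘ H) (2 * c) + count sentBelow (2 * c) ≤⟨ +-monoʳ-≤ _ count-sentBelow ⟩
    count (A ∘ H) (2 * c) + c                       ∎)
    where
    open ≤-Reasoning
    c : ℕ
    c = count B (t j)
    sentBelow : Subset
    sentBelow x = H x <ᵇ t j
    window-covered : ∀ x → x < 2 * c → T (A (H x)) ⊎ T (sentBelow x)
    window-covered x x<2c with H x <? t j
    ... | yes Hx<tj = inj₂ (<⇒<ᵇ Hx<tj)
    ... | no  Hx≮tj = inj₁ (Equivalence.from T-∧ (proj₂ (h x) ,
            subst (T ∘ W) (sym (h⁻¹-H x)) (fromWitness (j , x<2c , ≮⇒≥ Hx≮tj))))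
    count-sentBelow : count sentBelow (2 * c) ≤ c
    count-sentBelow = pigeonhole H (2 * c) (t j)
      (λ x _ below → <ᵇ⇒< (H x) (t j) below , proj₂ (h x)) (λ _ _ → H-injective)

  h⁻¹[A]-not-null : ¬ InId (A ∘ H)
  h⁻¹[A]-not-null null with null 3
  ... | N , bound = <⇒≱ (*-monoˡ-< c {2} {3} ≤-refl) (begin
    3 * c                            ≤⟨ *-monoʳ-≤ 3 (count-h⁻¹[A] N) ⟩
    3 * count (A ∘ H) (2 * c)        ≤⟨ bound (2 * c) (≤-trans (<⇒≤ (j<count-t N)) (m≤m+n c _)) ⟩
    2 * c                            ∎)
    where
    open ≤-Reasoning
    c : ℕ
    c = count B (t N)
    instance
      c-nonZero : NonZero c
      c-nonZero = >-nonZero (≤-<-trans z≤n (j<count-t N))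

InH⇒PosLowerDensity : ExcludedMiddle 0ℓ → ∀ B → InH B → PosLowerDensity B
InH⇒PosLowerDensity em B (h , h-bijective , h-iso) = decidable-stable em λ ¬positive →
  let open LowerDensityZero em (¬PosLowerDensity⇒sparse em ¬positive) h h-bijective
  in h⁻¹[A]-not-null (Equivalence.to (h-iso A A⊆B) (Equivalence.from (InRestr⇔InId A⊆B) A-null))

mainTheorem15 : ExcludedMiddle 0ℓ → (B : Subset) → InH B ⇔ PosLowerDensity B
mainTheorem15 em B = mk⇔ (InH⇒PosLowerDensity em B) PositiveLowerDensity.inH
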